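{- Let $X$ be a finite set of variables, $\preccurlyeq$ a monomial ordering, $F\subseteq\mathbb{Z}_2[X]$, and let $\mathcal S_F$ be the set of polynomials in $\mathbb{Z}_2[X]$ that are not residual with respect to $F$. If $g\in\langle F\rangle$ is nonzero, then $\mathcal{HT}(g)\in\mathcal S_F$. Furthermore, $\mathcal S_F$ is upward closed with respect to $\triangleleft$: if $g\in\mathcal S_F$ and $g\triangleleft f$, then $f\in\mathcal S_F$.
   Context: $\mathbb{Z}_2$ is the field with two elements; $\langle F\rangle$ is the ideal generated by $F$. A monomial ordering is a total order $\preccurlyeq$ on monomials with $1\preccurlyeq t$ for all $t$ and $t_1\preccurlyeq t_2\Rightarrow t_1t_3\preccurlyeq t_2t_3$. For nonzero $g$, $\mathcal{HT}(g)$ is the highest monomial of $g$. The ordering is extended to polynomials by: $g\preccurlyeq f$ iff $g=f$, or $\mathcal{HT}(g)\prec\mathcal{HT}(f)$, or $\mathcal{HT}(g)=\mathcal{HT}(f)=t$ and $g-t\preccurlyeq f-t$ (recursively; $0$ is below every nonzero polynomial). A polynomial $f$ is residual w.r.t. $F$ if for every $g$ with $f+g\in\langle F\rangle$ we have $f\preccurlyeq g$. For polynomials $p,q$, $p\triangleleft q$ means there is an injective map $\phi$ from the monomials occurring in $p$ to the monomials occurring in $q$ with each $t$ dividing $\phi(t)$. -}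

module Defs where

open import Data.Nat as ℕ using (ℕ)
open import Data.Bool using (Bool; true; false; _xor_)
open import Data.Vec using (Vec; replicate; zipWith)
open import Data.Vec.Relation.Binary.Pointwise.Inductive using (Pointwise)
import Data.Vec.Properties as VecP
open import Data.List using (List; []; _∷_; _++_; filter; map; foldr; deduplicate; [_])
open import Data.List.Membership.Propositional using (_∈_; _∉_)
import Data.List.Membership.DecPropositional as DecMem
open import Data.List.Relation.Unary.All using (All)
open import Data.Product using (Σ; _×_; _,_; proj₁; proj₂)
open import Relation.Binary.PropositionalEquality using (_≡_)
open import Relation.Binary.Definitions using (DecidableEquality)
open import Relation.Nullary using (¬_; does)
open import Function.Bundles using (_⇔_)
open import Data.Sum using (_⊎_)

Mon : ℕ → Set
Mon n = Vec ℕ n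

one : ∀ {n} → Mon n
one = replicate _ 0

_⊗_ : ∀ {n} → Mon n → Mon n → Mon n
_⊗_ = zipWith ℕ._+_

_∣ₘ_ : ∀ {n} → Mon n → Mon n → Set
s ∣ₘ t = Pointwise ℕ._≤_ s t

_≟ₘ_ : ∀ {n} → DecidableEquality (Mon n)
_≟ₘ_ = VecP.≡-dec ℕ._≟_

record MonomialOrder (n : ℕ) : Set₁ where
  field
    _≼_     : Mon n → Mon n → Set
    refl≼   : ∀ t → t ≼ t
    trans≼  : ∀ {s t u} → s ≼ t → t ≼ u → s ≼ u
    antisym : ∀ {s t} → s ≼ t → t ≼ s → s ≡ t
    total   : ∀ s t → (s ≼ t) ⊎ (t ≼ s)
    one≼    : ∀ t → one ≼ t
    compat  : ∀ {t₁ t₂} t₃ → t₁ ≼ t₂ → (t₁ ⊗ t₃) ≼ (t₂ ⊗ t₃)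

  _≺_ : Mon n → Mon n → Set
  s ≺ t = s ≼ t × ¬ (s ≡ t)

-- Polynomials over ℤ₂ : a polynomial is the (finite) set of monomials
-- occurring in it (coefficient 1), represented by a list; the
-- coefficient of t is 1 iff t ∈ p (duplicates in the list are irrelevant).

Poly : ℕ → Set
Poly n = List (Mon n)

module _ {n : ℕ} where
  open DecMem (_≟ₘ_ {n}) using (_∈?_)

  _≈_ : Poly n → Poly n → Set
  p ≈ q = ∀ t → (t ∈ p) ⇔ (t ∈ q)

  0ₚ : Poly n
  0ₚ = []

  monoₚ : Mon n → Poly n
  monoₚ t = [ t ]

  _⊕_ : Poly n → Poly n → Poly n
  p ⊕ q = filter (λ t → Data.Bool.T? (does (t ∈? p) xor does (t ∈? q))) (p ++ q)
    where import Data.Bool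

  _⊛_ : Poly n → Poly n → Poly n
  p ⊛ q = foldr (λ a acc → map (a ⊗_) q ⊕ acc) 0ₚ (deduplicate _≟ₘ_ p)

  InIdeal : (Poly n → Set) → Poly n → Set
  InIdeal F g = Σ (List (Poly n × Poly n)) λ hfs →
                  All (λ hf → F (proj₂ hf)) hfs ×
                  (g ≈ foldr (λ hf acc → (proj₁ hf ⊛ proj₂ hf) ⊕ acc) 0ₚ hfs)

  _◁_ : Poly n → Poly n → Set
  p ◁ q = Σ (Mon n → Mon n) λ φ →
            (∀ t → t ∈ p → (φ t ∈ q) × (t ∣ₘ φ t)) ×
            (∀ s t → s ∈ p → t ∈ p → φ s ≡ φ t → s ≡ t)

module _ {n : ℕ} (O : MonomialOrder n) where
  open MonomialOrder O

  IsHT : Poly n → Mon n → Set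
  IsHT g t = t ∈ g × (∀ s → s ∈ g → s ≼ t)

  data _≼ₚ_ : Poly n → Poly n → Set where
    eq≼   : ∀ {g f} → g ≈ f → g ≼ₚ f
    zero≼ : ∀ {g f} → g ≈ 0ₚ → ¬ (f ≈ 0ₚ) → g ≼ₚ f
    head≺ : ∀ {g f s t} → IsHT g s → IsHT f t → s ≺ t → g ≼ₚ f
    head≡ : ∀ {g f t} → IsHT g t → IsHT f t →
            (g ⊕ monoₚ t) ≼ₚ (f ⊕ monoₚ t) → g ≼ₚ f

  Residual : (Poly n → Set) → Poly n → Set
  Residual F f = ∀ g → InIdeal F (f ⊕ g) → f ≼ₚ g

  InS : (Poly n → Set) → Poly n → Set
  InS F f = ¬ Residual F f

{-# OPTIONS --safe #-}
-- Over ℤ₂, g ≼ₚ h holds exactly when g = h or the largest monomial of g + h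
-- lies in h.  Hence f is residual iff no monomial of f is the head term of an
-- element d of ⟨F⟩: such a monomial makes f ⋠ f + d although
-- f + (f + d) = d ∈ ⟨F⟩, and conversely f ⋠ h with f + h ∈ ⟨F⟩ puts
-- HT(f + h) into f.  Since HT(m·d) = m·HT(d), the head terms of ⟨F⟩ are
-- closed under taking multiples.  So HT(g) for nonzero g ∈ ⟨F⟩ is a head term
-- lying in the monomial HT(g), and if g ◁ f every monomial of g divides one
-- of f, so a head term in g yields a head term in f.
module Submission where

open import Defs
open import Data.Nat using (ℕ)
open import Data.Product using (Σ; _×_)
open import Relation.Nullary using (¬_)

open import Data.Bool using (_xor_; T)
open import Data.Empty using (⊥-elim)
open import Data.List using (List; []; _∷_; _++_; map; foldr; filter; deduplicate; [_]; length)
import Data.List.Properties as List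
open import Data.List.Membership.Propositional using (_∈_; _∉_)
open import Data.List.Membership.Propositional.Properties
  using (∈-map⁺; ∈-map⁻; ∈-filter⁺; ∈-filter⁻; ∈-++⁺ˡ; ∈-++⁺ʳ)
import Data.List.Membership.DecPropositional as DecMembership
open import Data.List.Relation.Unary.Any using (here; there)
import Data.List.Relation.Unary.Any as Any
open import Data.List.Relation.Unary.All.Properties using () renaming (map⁺ to All-map⁺)
import Data.List.Relation.Binary.Subset.Propositional.Properties as Subset
open import Data.Nat using (_<_; _∸_)
import Data.Nat.Properties as ℕ
open import Data.Nat.Induction using (<-wellFounded)
open import Induction.WellFounded using (Acc; acc)
open import Data.Product using (_,_; proj₁; proj₂; ∃; map₁)
open import Data.Sum using (_⊎_; inj₁; inj₂)
open import Data.Unit using (tt)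
open import Data.Vec using ([]; _∷_)
import Data.Vec.Properties as Vec
open import Data.Vec.Relation.Binary.Pointwise.Inductive using ([]; _∷_)
open import Function using (_∘_)
open import Function.Bundles using (_⇔_; mk⇔; Equivalence)
import Function.Properties.Equivalence as ⇔
open import Function.Definitions using (Injective)
open import Relation.Binary.Definitions using (DecidableEquality)
open import Relation.Binary.PropositionalEquality
  using (_≡_; _≢_; refl; sym; cong; cong₂; subst; module ≡-Reasoning)
open import Relation.Nullary using (Dec; yes; no; does; ¬?)
open import Relation.Nullary.Decidable using (decidable-stable; T?)

open Equivalence using (to; from)

private
  variable
    n : ℕ
    A B : Set
    s t u : Mon n
    p q r p′ q′ : Poly n
    F : Poly n → Set

  _∈?_ : (t : Mon n) (p : Poly n) → Dec (t ∈ p)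
  _∈?_ = DecMembership._∈?_ _≟ₘ_

  in-exactly-one? : (p q : Poly n) (t : Mon n) → Dec (T (does (t ∈? p) xor does (t ∈? q)))
  in-exactly-one? p q t = T? (does (t ∈? p) xor does (t ∈? q))

xor-does⁺ : (a? : Dec A) (b? : Dec B) → (A × ¬ B) ⊎ (¬ A × B) → T (does a? xor does b?)
xor-does⁺ (yes _) (no _)  _               = tt
xor-does⁺ (no _)  (yes _) _               = tt
xor-does⁺ (yes _) (yes b) (inj₁ (_ , ¬b)) = ¬b b
xor-does⁺ (yes a) (yes _) (inj₂ (¬a , _)) = ¬a a
xor-does⁺ (no ¬a) (no _)  (inj₁ (a , _))  = ¬a a
xor-does⁺ (no _)  (no ¬b) (inj₂ (_ , b))  = ¬b b

xor-does⁻ : (a? : Dec A) (b? : Dec B) → T (does a? xor does b?) → (A × ¬ B) ⊎ (¬ A × B)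
xor-does⁻ (yes a) (no ¬b) _ = inj₁ (a , ¬b)
xor-does⁻ (no ¬a) (yes b) _ = inj₂ (¬a , b)
xor-does⁻ (yes _) (yes _) ()
xor-does⁻ (no _)  (no _)  ()

map-deduplicate : (_≟A_ : DecidableEquality A) (_≟B_ : DecidableEquality B) {f : A → B} →
                  Injective _≡_ _≡_ f →
                  ∀ xs → map f (deduplicate _≟A_ xs) ≡ deduplicate _≟B_ (map f xs)
map-deduplicate _≟A_ _≟B_ f-inj [] = refl
map-deduplicate _≟A_ _≟B_ {f} f-inj (x ∷ xs) = cong (f x ∷_) (begin
  map f (filter (¬? ∘ (x ≟A_)) (deduplicate _≟A_ xs))
    ≡⟨ map-filter-≢ (deduplicate _≟A_ xs) ⟩
  filter (¬? ∘ (f x ≟B_)) (map f (deduplicate _≟A_ xs))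
    ≡⟨ cong (filter (¬? ∘ (f x ≟B_))) (map-deduplicate _≟A_ _≟B_ f-inj xs) ⟩
  filter (¬? ∘ (f x ≟B_)) (deduplicate _≟B_ (map f xs))
    ∎)
  where
  open ≡-Reasoning
  map-filter-≢ : ∀ ys → map f (filter (¬? ∘ (x ≟A_)) ys) ≡ filter (¬? ∘ (f x ≟B_)) (map f ys)
  map-filter-≢ [] = refl
  map-filter-≢ (y ∷ ys) with x ≟A y | f x ≟B f y
  ... | yes _    | yes _    = map-filter-≢ ys
  ... | no _     | no _     = cong (f y ∷_) (map-filter-≢ ys)
  ... | yes x≡y  | no fx≢fy = ⊥-elim (fx≢fy (cong f x≡y))
  ... | no x≢y   | yes fx≡fy = ⊥-elim (x≢y (f-inj fx≡fy))

∉0ₚ : t ∉ 0ₚ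
∉0ₚ ()

≈-refl : p ≈ p
≈-refl _ = ⇔.refl

≈-sym : p ≈ q → q ≈ p
≈-sym p≈q t = ⇔.sym (p≈q t)

≈-trans : p ≈ q → q ≈ r → p ≈ r
≈-trans p≈q q≈r t = ⇔.trans (p≈q t) (q≈r t)

≡⇒≈ : p ≡ q → p ≈ q
≡⇒≈ refl = ≈-refl

⊕⊆++ : ∀ p q → t ∈ p ⊕ q → t ∈ p ++ q
⊕⊆++ p q = proj₁ ∘ ∈-filter⁻ (in-exactly-one? p q) {xs = p ++ q}

∈-⊕⁻ : ∀ p q → t ∈ p ⊕ q → (t ∈ p × t ∉ q) ⊎ (t ∉ p × t ∈ q)
∈-⊕⁻ {t = t} p q =
  xor-does⁻ (t ∈? p) (t ∈? q) ∘ proj₂ ∘ ∈-filter⁻ (in-exactly-one? p q) {xs = p ++ q}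

∈-⊕⁺ : (t ∈ p × t ∉ q) ⊎ (t ∉ p × t ∈ q) → t ∈ p ⊕ q
∈-⊕⁺ {t = t} {p = p} {q} in-one@(inj₁ (t∈p , _)) =
  ∈-filter⁺ (in-exactly-one? p q) (∈-++⁺ˡ t∈p) (xor-does⁺ (t ∈? p) (t ∈? q) in-one)
∈-⊕⁺ {t = t} {p = p} {q} in-one@(inj₂ (_ , t∈q)) =
  ∈-filter⁺ (in-exactly-one? p q) (∈-++⁺ʳ p t∈q) (xor-does⁺ (t ∈? p) (t ∈? q) in-one)

∉-⊕-both : t ∈ p → t ∈ q → t ∉ p ⊕ q
∉-⊕-both {p = p} {q} t∈p t∈q t∈p⊕q with ∈-⊕⁻ p q t∈p⊕q
... | inj₁ (_ , t∉q) = t∉q t∈q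
... | inj₂ (t∉p , _) = t∉p t∈p

∉-⊕-neither : t ∉ p → t ∉ q → t ∉ p ⊕ q
∉-⊕-neither {p = p} {q} t∉p t∉q t∈p⊕q with ∈-⊕⁻ p q t∈p⊕q
... | inj₁ (t∈p , _) = t∉p t∈p
... | inj₂ (_ , t∈q) = t∉q t∈q

∈-⊕-resp : (t ∈ p ⇔ u ∈ p′) → (t ∈ q ⇔ u ∈ q′) → t ∈ p ⊕ q → u ∈ p′ ⊕ q′
∈-⊕-resp {p = p} {q = q} p⇔p′ q⇔q′ t∈p⊕q with ∈-⊕⁻ p q t∈p⊕q
... | inj₁ (t∈p , t∉q) = ∈-⊕⁺ (inj₁ (to p⇔p′ t∈p , t∉q ∘ from q⇔q′))
... | inj₂ (t∉p , t∈q) = ∈-⊕⁺ (inj₂ (t∉p ∘ from p⇔p′ , to q⇔q′ t∈q))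

⊕-cong : p ≈ p′ → q ≈ q′ → (p ⊕ q) ≈ (p′ ⊕ q′)
⊕-cong p≈p′ q≈q′ t =
  mk⇔ (∈-⊕-resp (p≈p′ t) (q≈q′ t)) (∈-⊕-resp (≈-sym p≈p′ t) (≈-sym q≈q′ t))

⊕-cancelˡ : ∀ (p q : Poly n) → (p ⊕ (p ⊕ q)) ≈ q
⊕-cancelˡ p q t = mk⇔ cancel restore
  where
  cancel : t ∈ p ⊕ (p ⊕ q) → t ∈ q
  cancel t∈ with ∈-⊕⁻ p (p ⊕ q) t∈
  ... | inj₁ (t∈p , t∉p⊕q) =
    decidable-stable (t ∈? q) (λ t∉q → t∉p⊕q (∈-⊕⁺ (inj₁ (t∈p , t∉q))))
  ... | inj₂ (t∉p , t∈p⊕q) with ∈-⊕⁻ p q t∈p⊕q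
  ...   | inj₁ (t∈p , _) = ⊥-elim (t∉p t∈p)
  ...   | inj₂ (_ , t∈q) = t∈q
  restore : t ∈ q → t ∈ p ⊕ (p ⊕ q)
  restore t∈q with t ∈? p
  ... | yes t∈p = ∈-⊕⁺ (inj₁ (t∈p , ∉-⊕-both t∈p t∈q))
  ... | no t∉p  = ∈-⊕⁺ (inj₂ (t∉p , ∈-⊕⁺ (inj₂ (t∉p , t∈q))))

⊕≈0ₚ⇒≈ : (p ⊕ q) ≈ 0ₚ → p ≈ q
⊕≈0ₚ⇒≈ {p = p} {q} p⊕q≈0 t = mk⇔
  (λ t∈p → decidable-stable (t ∈? q) (λ t∉q → t∉p⊕q (∈-⊕⁺ (inj₁ (t∈p , t∉q)))))
  (λ t∈q → decidable-stable (t ∈? p) (λ t∉p → t∉p⊕q (∈-⊕⁺ (inj₂ (t∉p , t∈q)))))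
  where
  t∉p⊕q : t ∉ p ⊕ q
  t∉p⊕q = ∉0ₚ ∘ to (p⊕q≈0 t)

length-⊕-∈ : s ∈ p → length (p ⊕ [ s ]) < length p
length-⊕-∈ {s = s} {p = p} s∈p =
  subst (_< length p) (sym (cong length drop-s))
    (List.filter-notAll P? p (Any.map (λ { refl → ¬Ps }) s∈p))
  where
  open ≡-Reasoning
  P? = in-exactly-one? p [ s ]
  ¬Ps : ¬ T (does (s ∈? p) xor does (s ∈? [ s ]))
  ¬Ps Ps with xor-does⁻ (s ∈? p) (s ∈? [ s ]) Ps
  ... | inj₁ (_ , s∉s) = s∉s (here refl)
  ... | inj₂ (s∉p , _) = s∉p s∈p
  drop-s : p ⊕ [ s ] ≡ filter P? p
  drop-s = begin
    filter P? (p ++ [ s ])         ≡⟨ List.filter-++ P? p [ s ] ⟩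
    filter P? p ++ filter P? [ s ] ≡⟨ cong (filter P? p ++_) (List.filter-reject P? ¬Ps) ⟩
    filter P? p ++ []              ≡⟨ List.++-identityʳ _ ⟩
    filter P? p                    ∎

map-resp-≈ : (f : Mon n → Mon n) → p ≈ q → map f p ≈ map f q
map-resp-≈ f p≈q t = mk⇔ (Subset.map⁺ f (to (p≈q _))) (Subset.map⁺ f (from (p≈q _)))

map-⊕ : {f : Mon n → Mon n} → Injective _≡_ _≡_ f →
        ∀ p q → map f (p ⊕ q) ≈ (map f p ⊕ map f q)
map-⊕ {f = f} f-inj p q t = mk⇔ push pull
  where
  ∈-image : ∀ {v} r → v ∈ r ⇔ f v ∈ map f r
  ∈-image r = mk⇔ (∈-map⁺ f) (λ fv∈ → preimage (∈-map⁻ f fv∈))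
    where
    preimage : ∀ {v} → ∃ (λ w → w ∈ r × f v ≡ f w) → v ∈ r
    preimage (w , w∈r , fv≡fw) = subst (_∈ r) (sym (f-inj fv≡fw)) w∈r
  push : t ∈ map f (p ⊕ q) → t ∈ map f p ⊕ map f q
  push t∈ with ∈-map⁻ f t∈
  ... | v , v∈p⊕q , refl = ∈-⊕-resp (∈-image p) (∈-image q) v∈p⊕q
  pull : t ∈ map f p ⊕ map f q → t ∈ map f (p ⊕ q)
  pull t∈ with ∈-map⁻ f (subst (t ∈_) (sym (List.map-++ f p q)) (⊕⊆++ (map f p) (map f q) t∈))
  ... | v , _ , refl = ∈-map⁺ f (∈-⊕-resp (⇔.sym (∈-image p)) (⇔.sym (∈-image q)) t∈)

⊗-assoc : ∀ (r s t : Mon n) → (r ⊗ s) ⊗ t ≡ r ⊗ (s ⊗ t)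
⊗-assoc = Vec.zipWith-assoc ℕ.+-assoc

⊗-comm : ∀ (s t : Mon n) → s ⊗ t ≡ t ⊗ s
⊗-comm = Vec.zipWith-comm ℕ.+-comm

⊗-cancelʳ : ∀ (m : Mon n) → Injective _≡_ _≡_ (_⊗ m)
⊗-cancelʳ []      {[]}    {[]}    _ = refl
⊗-cancelʳ (k ∷ m) {a ∷ s} {b ∷ t} e =
  cong₂ _∷_ (ℕ.+-cancelʳ-≡ k a b (Vec.∷-injectiveˡ e)) (⊗-cancelʳ m (Vec.∷-injectiveʳ e))

∣ₘ⇒∃-cofactor : s ∣ₘ t → ∃ λ m → t ≡ s ⊗ m
∣ₘ⇒∃-cofactor [] = [] , refl
∣ₘ⇒∃-cofactor {s = a ∷ _} {t = b ∷ _} (a≤b ∷ s∣t) with ∣ₘ⇒∃-cofactor s∣t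
... | m , t≡s⊗m = (b ∸ a) ∷ m , cong₂ _∷_ (sym (ℕ.m+[n∸m]≡n a≤b)) t≡s⊗m

infixl 7 _⊗ₚ_
_⊗ₚ_ : Poly n → Mon n → Poly n
p ⊗ₚ m = map (_⊗ m) p

⊛-⊗ₚ : ∀ (h f : Poly n) m → ((h ⊛ f) ⊗ₚ m) ≈ ((h ⊗ₚ m) ⊛ f)
⊛-⊗ₚ h f m = ≈-trans (multiples-⊗ₚ (deduplicate _≟ₘ_ h))
  (≡⇒≈ (cong multiples (map-deduplicate _≟ₘ_ _≟ₘ_ (⊗-cancelʳ m) h)))
  where
  open ≡-Reasoning
  multiples : List (Mon _) → Poly _
  multiples = foldr (λ a acc → map (a ⊗_) f ⊕ acc) 0ₚ
  shift : ∀ a → map (a ⊗_) f ⊗ₚ m ≡ map ((a ⊗ m) ⊗_) f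
  shift a = begin
    map (_⊗ m) (map (a ⊗_) f)   ≡⟨ List.map-∘ f ⟨
    map (λ v → (a ⊗ v) ⊗ m) f   ≡⟨ List.map-cong (λ v → begin
      (a ⊗ v) ⊗ m                  ≡⟨ ⊗-assoc a v m ⟩
      a ⊗ (v ⊗ m)                  ≡⟨ cong (a ⊗_) (⊗-comm v m) ⟩
      a ⊗ (m ⊗ v)                  ≡⟨ ⊗-assoc a m v ⟨
      (a ⊗ m) ⊗ v                  ∎) f ⟩
    map ((a ⊗ m) ⊗_) f          ∎
  multiples-⊗ₚ : ∀ as → (multiples as ⊗ₚ m) ≈ multiples (as ⊗ₚ m)
  multiples-⊗ₚ []       = ≈-refl
  multiples-⊗ₚ (a ∷ as) = ≈-trans (map-⊕ (⊗-cancelʳ m) (map (a ⊗_) f) (multiples as))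
                                  (⊕-cong (≡⇒≈ (shift a)) (multiples-⊗ₚ as))

InIdeal-resp-≈ : p ≈ q → InIdeal F p → InIdeal F q
InIdeal-resp-≈ p≈q (hfs , hfs∈F , p≈Σ) = hfs , hfs∈F , ≈-trans (≈-sym p≈q) p≈Σ

InIdeal-⊗ₚ : ∀ m → InIdeal F p → InIdeal F (p ⊗ₚ m)
InIdeal-⊗ₚ {F = F} m (hfs , hfs∈F , p≈Σ) =
  map (map₁ (_⊗ₚ m)) hfs , All-map⁺ hfs∈F ,
  ≈-trans (map-resp-≈ (_⊗ m) p≈Σ) (combination-⊗ₚ hfs)
  where
  combination : List (Poly _ × Poly _) → Poly _
  combination = foldr (λ hf acc → (proj₁ hf ⊛ proj₂ hf) ⊕ acc) 0ₚ
  combination-⊗ₚ : ∀ hfs → (combination hfs ⊗ₚ m) ≈ combination (map (map₁ (_⊗ₚ m)) hfs)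
  combination-⊗ₚ []             = ≈-refl
  combination-⊗ₚ ((h , f) ∷ hfs) =
    ≈-trans (map-⊕ (⊗-cancelʳ m) (h ⊛ f) (combination hfs))
            (⊕-cong (⊛-⊗ₚ h f m) (combination-⊗ₚ hfs))

module _ {n : ℕ} (O : MonomialOrder n) where
  open MonomialOrder O

  head-term : ∀ x xs → ∃ (IsHT O (x ∷ xs))
  head-term x [] = x , here refl , λ { _ (here refl) → refl≼ x ; _ (there ()) }
  head-term x (y ∷ ys) with head-term y ys
  ... | s , s∈ , ≼s with total x s
  ...   | inj₁ x≼s = s , there s∈ , λ { _ (here refl) → x≼s ; u (there u∈) → ≼s u u∈ }
  ...   | inj₂ s≼x =
    x , here refl , λ { _ (here refl) → refl≼ x ; u (there u∈) → trans≼ (≼s u u∈) s≼x }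

  zero-or-head-term : ∀ (p : Poly n) → p ≈ 0ₚ ⊎ ∃ (IsHT O p)
  zero-or-head-term []       = inj₁ ≈-refl
  zero-or-head-term (x ∷ xs) = inj₂ (head-term x xs)

  IsHT-resp-≈ : {p q : Poly n} {t : Mon n} → p ≈ q → IsHT O p t → IsHT O q t
  IsHT-resp-≈ p≈q (t∈p , ≼t) = to (p≈q _) t∈p , λ u u∈q → ≼t u (from (p≈q u) u∈q)

  IsHT-⊗ₚ : {p : Poly n} {t : Mon n} → ∀ m → IsHT O p t → IsHT O (p ⊗ₚ m) (t ⊗ m)
  IsHT-⊗ₚ {p} {t} m (t∈p , ≼t) = ∈-map⁺ (_⊗ m) t∈p , ≼t⊗m
    where
    ≼t⊗m : ∀ u → u ∈ p ⊗ₚ m → u ≼ (t ⊗ m)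
    ≼t⊗m u u∈ with ∈-map⁻ (_⊗ m) u∈
    ... | v , v∈p , refl = compat m (≼t v v∈p)

  AgreeAbove : Mon n → Poly n → Poly n → Set
  AgreeAbove t p q = ∀ u → t ≺ u → (u ∈ p ⇔ u ∈ q)

  AgreeAbove-⊕ : {p q : Poly n} {t : Mon n} →
                 ∀ r → AgreeAbove t p q → AgreeAbove t (p ⊕ r) (q ⊕ r)
  AgreeAbove-⊕ r agree u t≺u =
    mk⇔ (∈-⊕-resp (agree u t≺u) (≈-refl u)) (∈-⊕-resp (⇔.sym (agree u t≺u)) (≈-refl u))

  head-of-⊕⇒AgreeAbove : {p q : Poly n} {t : Mon n} → IsHT O (p ⊕ q) t → AgreeAbove t p q
  head-of-⊕⇒AgreeAbove {p} {q} (_ , ≼t) u (t≼u , t≢u) = mk⇔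
    (λ u∈p → decidable-stable (u ∈? q) (λ u∉q → u∉p⊕q (∈-⊕⁺ (inj₁ (u∈p , u∉q)))))
    (λ u∈q → decidable-stable (u ∈? p) (λ u∉p → u∉p⊕q (∈-⊕⁺ (inj₂ (u∉p , u∈q)))))
    where
    u∉p⊕q : u ∉ p ⊕ q
    u∉p⊕q u∈ = t≢u (antisym t≼u (≼t u u∈))

  first-difference-left⇒≰ₚ : {p q : Poly n} {t : Mon n} →
                             t ∈ p → t ∉ q → AgreeAbove t p q → ¬ _≼ₚ_ O p q
  first-difference-left⇒≰ₚ t∈p t∉q _ (eq≼ p≈q) = t∉q (to (p≈q _) t∈p)
  first-difference-left⇒≰ₚ t∈p _ _ (zero≼ p≈0 _) = ∉0ₚ (to (p≈0 _) t∈p)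
  first-difference-left⇒≰ₚ {t = t} t∈p t∉q agree
                           (head≺ {t = s′} (_ , ≼s) (s′∈q , _) (s≼s′ , s≢s′)) =
    s≢s′ (antisym s≼s′ (≼s s′ (from (agree s′ t≺s′) s′∈q)))
    where
    t≺s′ : t ≺ s′
    t≺s′ = trans≼ (≼s t t∈p) s≼s′ , λ { refl → t∉q s′∈q }
  first-difference-left⇒≰ₚ t∈p t∉q agree (head≡ {t = s} _ (s∈q , _) p≼q-below-s) =
    first-difference-left⇒≰ₚ (∈-⊕⁺ (inj₁ (t∈p , t∉[s]))) (∉-⊕-neither t∉q t∉[s])
      (AgreeAbove-⊕ [ s ] agree) p≼q-below-s
    where
    t∉[s] : _ ∉ [ s ]
    t∉[s] (here refl) = t∉q s∈q

  first-difference-right⇒≼ₚ : {p q : Poly n} {t : Mon n} →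
                              t ∉ p → t ∈ q → AgreeAbove t p q → _≼ₚ_ O p q
  first-difference-right⇒≼ₚ {q = q} = go (<-wellFounded (length q))
    where
    go : {p q : Poly n} {t : Mon n} → Acc _<_ (length q) →
         t ∉ p → t ∈ q → AgreeAbove t p q → _≼ₚ_ O p q
    go {[]} _ _ t∈q _ = zero≼ ≈-refl (λ q≈0 → ∉0ₚ (to (q≈0 _) t∈q))
    go {_ ∷ _} {[]} _ _ () _
    go {p@(x ∷ xs)} {q@(y ∷ ys)} {t} (acc smaller) t∉p t∈q agree with head-term x xs
    ... | s , HTp@(s∈p , ≼s) with total s t
    ...   | inj₁ s≼t = head≺ HTp HTq (s≼s′ , s≢s′)
      where
      s′  = proj₁ (head-term y ys)
      HTq = proj₂ (head-term y ys)
      t≼s′ = proj₂ HTq t t∈q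
      s≼s′ = trans≼ s≼t t≼s′
      s≢s′ : s ≢ s′
      s≢s′ refl = t∉p (subst (_∈ p) (antisym s≼t t≼s′) s∈p)
    ...   | inj₂ t≼s =
      head≡ HTp (s∈q , ≼s-on-q)
        (go (smaller (length-⊕-∈ s∈q)) (∉-⊕-neither t∉p t∉[s]) (∈-⊕⁺ (inj₁ (t∈q , t∉[s])))
            (AgreeAbove-⊕ [ s ] agree))
      where
      t≢s : t ≢ s
      t≢s refl = t∉p s∈p
      t∉[s] : t ∉ [ s ]
      t∉[s] (here t≡s) = t≢s t≡s
      s∈q : s ∈ q
      s∈q = to (agree s (t≼s , t≢s)) s∈p
      ≼s-on-q : ∀ u → u ∈ q → u ≼ s
      ≼s-on-q u u∈q with total u s
      ... | inj₁ u≼s = u≼s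
      ... | inj₂ s≼u = ≼s u (from (agree u (trans≼ t≼s s≼u , t≢u)) u∈q)
        where
        t≢u : t ≢ u
        t≢u refl = t≢s (antisym t≼s s≼u)

  head-of-⊕-in-left⇒≰ₚ : {p q : Poly n} {t : Mon n} →
                         IsHT O (p ⊕ q) t → t ∈ p → ¬ _≼ₚ_ O p q
  head-of-⊕-in-left⇒≰ₚ {p} {q} HT t∈p with ∈-⊕⁻ p q (proj₁ HT)
  ... | inj₁ (_ , t∉q) = first-difference-left⇒≰ₚ t∈p t∉q (head-of-⊕⇒AgreeAbove HT)
  ... | inj₂ (t∉p , _) = ⊥-elim (t∉p t∈p)

  head-of-⊕-in-right⇒≼ₚ : {p q : Poly n} {t : Mon n} →
                          IsHT O (p ⊕ q) t → t ∈ q → _≼ₚ_ O p q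
  head-of-⊕-in-right⇒≼ₚ {p} {q} HT t∈q with ∈-⊕⁻ p q (proj₁ HT)
  ... | inj₁ (_ , t∉q) = ⊥-elim (t∉q t∈q)
  ... | inj₂ (t∉p , _) = first-difference-right⇒≼ₚ t∉p t∈q (head-of-⊕⇒AgreeAbove HT)

module _ {n : ℕ} (O : MonomialOrder n) (F : Poly n → Set) where

  IdealHT : Mon n → Set
  IdealHT t = Σ (Poly n) λ d → InIdeal F d × IsHT O d t

  IdealHT-∣ₘ : {s t : Mon n} → IdealHT s → s ∣ₘ t → IdealHT t
  IdealHT-∣ₘ (d , d∈I , HTd) s∣t with ∣ₘ⇒∃-cofactor s∣t
  ... | m , refl = d ⊗ₚ m , InIdeal-⊗ₚ m d∈I , IsHT-⊗ₚ O m HTd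

  residual⇒avoids-IdealHT : {p : Poly n} {t : Mon n} → Residual O F p → IdealHT t → t ∉ p
  residual⇒avoids-IdealHT {p} p-residual (d , d∈I , HTd) t∈p =
    head-of-⊕-in-left⇒≰ₚ O (IsHT-resp-≈ O (≈-sym (⊕-cancelˡ p d)) HTd) t∈p
      (p-residual (p ⊕ d) (InIdeal-resp-≈ (≈-sym (⊕-cancelˡ p d)) d∈I))

  avoids-IdealHT⇒residual : {p : Poly n} → (∀ {t} → IdealHT t → t ∉ p) → Residual O F p
  avoids-IdealHT⇒residual {p} avoids q p⊕q∈I with zero-or-head-term O (p ⊕ q)
  ... | inj₁ p⊕q≈0 = eq≼ (⊕≈0ₚ⇒≈ p⊕q≈0)
  ... | inj₂ (t , HT) with ∈-⊕⁻ p q (proj₁ HT)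
  ...   | inj₁ (t∈p , _) = ⊥-elim (avoids (p ⊕ q , p⊕q∈I , HT) t∈p)
  ...   | inj₂ (_ , t∈q) = head-of-⊕-in-right⇒≼ₚ O HT t∈q

  Residual-∣ₘ-downward : {p q : Poly n} → (∀ {t} → t ∈ p → ∃ λ s → s ∈ q × t ∣ₘ s) →
                         Residual O F q → Residual O F p
  Residual-∣ₘ-downward {q = q} p∣q q-residual = avoids-IdealHT⇒residual λ HT t∈p →
    let s , s∈q , t∣s = p∣q t∈p
    in  residual⇒avoids-IdealHT {p = q} q-residual (IdealHT-∣ₘ HT t∣s) s∈q

lemma3p1 : ∀ {n : ℕ} (O : MonomialOrder n) (F : Poly n → Set) →
           (∀ g → InIdeal F g → ¬ (g ≈ 0ₚ) →
              Σ (Mon n) (λ t → IsHT O g t × InS O F (monoₚ t))) ×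
           (∀ g f → InS O F g → g ◁ f → InS O F f)
lemma3p1 O F = head-term-not-residual , ◁-upward
  where
  head-term-not-residual : ∀ g → InIdeal F g → ¬ (g ≈ 0ₚ) →
                           Σ (Mon _) (λ t → IsHT O g t × InS O F (monoₚ t))
  head-term-not-residual g g∈I g≉0 with zero-or-head-term O g
  ... | inj₁ g≈0 = ⊥-elim (g≉0 g≈0)
  ... | inj₂ (t , HTg) =
    t , HTg , λ t-residual →
      residual⇒avoids-IdealHT O F {p = monoₚ t} t-residual (g , g∈I , HTg) (here refl)

  ◁-upward : ∀ g f → InS O F g → g ◁ f → InS O F f
  ◁-upward g f g∈S (φ , φ-divides , _) f-residual =
    g∈S (Residual-∣ₘ-downward O F {p = g} {q = f} (λ {t} t∈g → φ t , φ-divides t t∈g)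
                              f-residual)
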